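{- Let $m\geqslant 4$ be an integer, let $w$ be an integer with $m\leqslant w\leqslant 2m-1$, and let $z=km+l$ with integers $1\leqslant k\leqslant 5m-1$ and $0\leqslant l<m$. If $k=1$, then $b_m(w)\,b_m(z)\geqslant b_m(w+z)$, with equality whenever $w+z\geqslant 3m$. If $k\geqslant 2$ and $m\geqslant 6$, then $b_m(w)\,b_m(z)>b_m(w+z)$.
   Context: For an integer $m\geqslant2$, the $m$-ary partition function $b_m(n)$ is the number of partitions of $n$ all of whose parts belong to $\{1,m,m^2,m^3,\ldots\}$. -}

module Defs where

open import Data.Nat using (ℕ; zero; suc; _+_; _*_; _∸_; _^_; _≤?_)
open import Relation.Nullary using (yes; no)

-- We iterate over the multiplicity t of the part m ^ j, t = 0 .. c,
-- contributing the partitions of n - t * m ^ j into smaller powers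
-- (only when t * m ^ j ≤ n).
mutual
  partsUpTo : ℕ → ℕ → ℕ → ℕ
  -- partsUpTo m j n = # partitions of n with all parts in {m ^ 0 , ... , m ^ j}
  partsUpTo m zero    n = 1
  partsUpTo m (suc j) n = sumMult m j n n

  sumMult : ℕ → ℕ → ℕ → ℕ → ℕ
  sumMult m j n zero    = partsUpTo m j n
  sumMult m j n (suc c) = sumMult m j n c + term m j n (suc c)

  term : ℕ → ℕ → ℕ → ℕ → ℕ
  term m j n t with (t * m ^ suc j) ≤? n
  ... | yes _ = partsUpTo m j (n ∸ t * m ^ suc j)
  ... | no  _ = 0

-- For m ≥ 2 every power m ^ j
-- with j > n exceeds n, so allowing parts m ^ 0 .. m ^ n captures all of them.
b : ℕ → ℕ → ℕ
b m n = partsUpTo m n n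

-- For m ≥ 2, a number n = a·m² + e·m + r with base-m digits a, e, r is smaller than m³, so
-- b_m(n) only counts parts 1, m, m² and equals digitCount m a e = (a+1)(e+1) + m·a(a+1)/2.
-- Here b_m(w) = 2 and, writing k = a·m + e, b_m(z) = digitCount m a e. Adding w to z raises
-- the middle digit e by δ ∈ {1, 2} (δ = 2 iff r + l carries). If e + δ < m this adds only
-- δ(a+1) to digitCount, which is less than digitCount m a e as soon as k ≥ 2 (for k = 1 it
-- gives 3 or 4 against 2·2). If e + δ carries into the m² digit, the gain of about (a+1)·m is
-- outweighed by the loss of the middle digit e ≥ m − 2, which is worth 2(a+1)(m−2) in 2·digitCount.

module Submission where

open import Data.Empty using (⊥-elim)
open import Data.Nat
open import Data.Nat.DivMod using (_/_; _%_; m≡m%n+[m/n]*n; m%n<n; m<n*o⇒m/o<n)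
open import Data.Nat.Properties
open import Data.Nat.Tactic.RingSolver using (solve-∀)
open import Data.Product using (_×_; _,_; ∃-syntax)
open import Data.Sum using (_⊎_; inj₁; inj₂)
open import Relation.Binary.PropositionalEquality
open import Relation.Nullary using (yes; no)

open import Defs

module LargestPart (m : ℕ) .{{_ : NonZero m}} (j : ℕ) where

  private
    M : ℕ
    M = m ^ suc j

  term-shift : ∀ n t → term m j (M + n) (suc t) ≡ term m j n t
  term-shift n t with suc t * m ^ suc j ≤? M + n | t * m ^ suc j ≤? n
  ... | yes _  | yes _  = cong (partsUpTo m j) ([m+n]∸[m+o]≡n∸o M n (t * M))
  ... | yes p  | no ¬q  = ⊥-elim (¬q (+-cancelˡ-≤ M _ _ p))
  ... | no ¬p  | yes q  = ⊥-elim (¬p (+-monoʳ-≤ M q))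
  ... | no _   | no _   = refl

  term-beyond : ∀ n t → n < t * M → term m j n t ≡ 0
  term-beyond n t n<tM with t * m ^ suc j ≤? n
  ... | yes tM≤n = ⊥-elim (<⇒≱ n<tM tM≤n)
  ... | no _     = refl

  sumMult-shift : ∀ n c → sumMult m j (M + n) (suc c) ≡ partsUpTo m j (M + n) + sumMult m j n c
  sumMult-shift n zero    = cong (partsUpTo m j (M + n) +_) (term-shift n 0)
  sumMult-shift n (suc c) = begin
    sumMult m j (M + n) (suc c) + term m j (M + n) (suc (suc c))
      ≡⟨ cong₂ _+_ (sumMult-shift n c) (term-shift n (suc c)) ⟩
    partsUpTo m j (M + n) + sumMult m j n c + term m j n (suc c)
      ≡⟨ +-assoc (partsUpTo m j (M + n)) _ _ ⟩
    partsUpTo m j (M + n) + sumMult m j n (suc c) ∎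
    where open ≡-Reasoning

  sumMult-beyond : ∀ n d → sumMult m j n (n + d) ≡ sumMult m j n n
  sumMult-beyond n zero    = cong (sumMult m j n) (+-identityʳ n)
  sumMult-beyond n (suc d) = begin
    sumMult m j n (n + suc d)                       ≡⟨ cong (sumMult m j n) (+-suc n d) ⟩
    sumMult m j n (n + d) + term m j n (suc (n + d)) ≡⟨ cong₂ _+_ (sumMult-beyond n d) (term-beyond n _ n<tM) ⟩
    sumMult m j n n + 0                             ≡⟨ +-identityʳ _ ⟩
    sumMult m j n n                                 ∎
    where
    open ≡-Reasoning
    n<tM : n < suc (n + d) * M
    n<tM = <-≤-trans (s≤s (m≤m+n n d)) (m≤m*n (suc (n + d)) M {{>-nonZero (m^n>0 m (suc j))}})

  sumMult-below : ∀ n c → n < M → sumMult m j n c ≡ partsUpTo m j n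
  sumMult-below n zero    n<M = refl
  sumMult-below n (suc c) n<M = begin
    sumMult m j n c + term m j n (suc c)
      ≡⟨ cong₂ _+_ (sumMult-below n c n<M) (term-beyond n (suc c) (<-≤-trans n<M (m≤m+n M (c * M)))) ⟩
    partsUpTo m j n + 0 ≡⟨ +-identityʳ _ ⟩
    partsUpTo m j n     ∎
    where open ≡-Reasoning

  partsUpTo-suc-+ : ∀ n → partsUpTo m (suc j) (M + n) ≡ partsUpTo m j (M + n) + partsUpTo m (suc j) n
  partsUpTo-suc-+ n = begin
    sumMult m j (M + n) (M + n)                  ≡⟨ cong (λ x → sumMult m j (M + n) (x + n)) M≡suc ⟩
    sumMult m j (M + n) (suc (pred M + n))       ≡⟨ sumMult-shift n (pred M + n) ⟩
    partsUpTo m j (M + n) + sumMult m j n (pred M + n)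
      ≡⟨ cong (λ x → partsUpTo m j (M + n) + sumMult m j n x) (+-comm (pred M) n) ⟩
    partsUpTo m j (M + n) + sumMult m j n (n + pred M)
      ≡⟨ cong (partsUpTo m j (M + n) +_) (sumMult-beyond n (pred M)) ⟩
    partsUpTo m j (M + n) + sumMult m j n n      ∎
    where
    open ≡-Reasoning
    M≡suc : M ≡ suc (pred M)
    M≡suc = sym (suc-pred M {{>-nonZero (m^n>0 m (suc j))}})

  partsUpTo-suc-< : ∀ n → n < M → partsUpTo m (suc j) n ≡ partsUpTo m j n
  partsUpTo-suc-< n = sumMult-below n n

-- Σ_{t ≤ a} (t·m + e + 1): a partition of a·m² + e·m + r (digits < m) into parts 1, m, m²
-- using a − t parts m² is fixed by its number of parts m, which ranges over t·m + e + 1 values.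
digitCount : ℕ → ℕ → ℕ → ℕ
digitCount m zero    e = suc e
digitCount m (suc a) e = suc a * m + suc e + digitCount m a e

digitCount-+ : ∀ m a e d → digitCount m a (e + d) ≡ digitCount m a e + d * suc a
digitCount-+ m zero    e d = cong suc (cong (e +_) (sym (*-identityʳ d)))
digitCount-+ m (suc a) e d = begin
  suc a * m + suc (e + d) + digitCount m a (e + d)
    ≡⟨ cong (suc a * m + suc (e + d) +_) (digitCount-+ m a e d) ⟩
  suc a * m + suc (e + d) + (digitCount m a e + d * suc a)
    ≡⟨ regroup (suc a * m) e d (digitCount m a e) a ⟩
  suc a * m + suc e + digitCount m a e + d * suc (suc a) ∎
  where
  open ≡-Reasoning
  regroup : ∀ p e d x a → p + suc (e + d) + (x + d * suc a) ≡ p + suc e + x + d * suc (suc a)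
  regroup = solve-∀

suc≤digitCount : ∀ m a e → suc e ≤ digitCount m a e
suc≤digitCount m zero    e = ≤-refl
suc≤digitCount m (suc a) e = ≤-trans (m≤n+m (suc e) (suc a * m)) (m≤m+n _ (digitCount m a e))

digitCount-+-< : ∀ {m a e δ} → 4 ≤ m → δ ≤ 2 → 2 ≤ a * m + e →
                 digitCount m a (e + δ) < 2 * digitCount m a e
digitCount-+-< {m} {a} {e} {δ} 4≤m δ≤2 2≤a*m+e = begin-strict
  digitCount m a (e + δ)          ≡⟨ digitCount-+ m a e δ ⟩
  digitCount m a e + δ * suc a    <⟨ +-monoʳ-< (digitCount m a e) (increment< a 2≤a*m+e) ⟩
  digitCount m a e + digitCount m a e ≡⟨ cong (digitCount m a e +_) (sym (+-identityʳ _)) ⟩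
  2 * digitCount m a e            ∎
  where
  open ≤-Reasoning
  increment< : ∀ a → 2 ≤ a * m + e → δ * suc a < digitCount m a e
  increment< zero    2≤e = s≤s (≤-trans (≤-reflexive (*-identityʳ δ)) (≤-trans δ≤2 2≤e))
  increment< (suc a) _   = begin-strict
    δ * suc (suc a)             ≤⟨ *-monoˡ-≤ (suc (suc a)) δ≤2 ⟩
    2 * suc (suc a)             ≤⟨ m≤m+n _ (2 * a) ⟩
    2 * suc (suc a) + 2 * a     ≡⟨ regroup a ⟩
    suc a * 4                   ≤⟨ *-monoʳ-≤ (suc a) 4≤m ⟩
    suc a * m                   <⟨ m<m+n (suc a * m) z<s ⟩
    suc a * m + suc e           ≤⟨ m≤m+n _ (digitCount m a e) ⟩
    digitCount m (suc a) e      ∎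
    where
    regroup : ∀ a → 2 * suc (suc a) + 2 * a ≡ suc a * 4
    regroup = solve-∀

digitCount-carry-< : ∀ {m a e e′} → 5 ≤ m → m + e′ ≤ e + 2 →
                     digitCount m (suc a) e′ < 2 * digitCount m a e
digitCount-carry-< {m} {a} {e} {e′} 5≤m m+e′≤e+2 =
  subst (λ y → digitCount m (suc a) e′ < 2 * digitCount m a y) (m+[n∸m]≡n e′≤e) (begin-strict
  suc a * m + suc e′ + x               ≤⟨ +-monoˡ-≤ x (+-monoʳ-≤ (suc a * m) (suc≤digitCount m a e′)) ⟩
  suc a * m + x + x                    <⟨ +-monoˡ-< x (+-monoˡ-< x (*-monoʳ-< (suc a) m<2d)) ⟩
  suc a * (2 * d) + x + x              ≡⟨ regroup a d x ⟩
  2 * (x + d * suc a)                  ≡⟨ cong (2 *_) (sym (digitCount-+ m a e′ d)) ⟩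
  2 * digitCount m a (e′ + d)          ∎)
  where
  open ≤-Reasoning
  x = digitCount m a e′
  d = e ∸ e′
  e′+m≤e+2 : e′ + m ≤ e + 2
  e′+m≤e+2 = ≤-trans (≤-reflexive (+-comm e′ m)) m+e′≤e+2
  e′≤e : e′ ≤ e
  e′≤e = +-cancelʳ-≤ 2 e′ e (≤-trans (+-monoʳ-≤ e′ (≤-trans (m≤m+n 2 3) 5≤m)) e′+m≤e+2)
  m≤d+2 : m ≤ d + 2
  m≤d+2 = +-cancelˡ-≤ e′ m (d + 2) (begin
    e′ + m        ≤⟨ e′+m≤e+2 ⟩
    e + 2         ≡⟨ cong (_+ 2) (sym (m+[n∸m]≡n e′≤e)) ⟩
    e′ + d + 2    ≡⟨ +-assoc e′ d 2 ⟩
    e′ + (d + 2)  ∎)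
  m<2d : m < 2 * d
  m<2d = begin-strict
    m             ≤⟨ m≤d+2 ⟩
    d + 2         <⟨ +-monoʳ-< d (+-cancelʳ-≤ 2 3 d (≤-trans 5≤m m≤d+2)) ⟩
    d + d         ≡⟨ cong (d +_) (sym (+-identityʳ d)) ⟩
    2 * d         ∎
  regroup : ∀ a d x → suc a * (2 * d) + x + x ≡ 2 * (x + d * suc a)
  regroup = solve-∀

q*m+r<n*m : ∀ {m q n r} → q < n → r < m → q * m + r < n * m
q*m+r<n*m {m} {q} {n} {r} q<n r<m = begin-strict
  q * m + r  <⟨ +-monoʳ-< (q * m) r<m ⟩
  q * m + m  ≡⟨ +-comm (q * m) m ⟩
  suc q * m  ≤⟨ *-monoˡ-≤ m q<n ⟩
  n * m      ∎
  where open ≤-Reasoning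

digit+carry : ∀ {m x} → x < m + m → ∃[ s ] s < m × (x ≡ s ⊎ x ≡ m + s)
digit+carry {m} {x} x<2m with x <? m
... | yes x<m = x , x<m , inj₁ refl
... | no x≮m  = x ∸ m , +-cancelˡ-< m (x ∸ m) m (subst (_< m + m) (sym x≡) x<2m) , inj₂ (sym x≡)
  where
  x≡ : m + (x ∸ m) ≡ x
  x≡ = m+[n∸m]≡n (≮⇒≥ x≮m)

module _ (m : ℕ) .{{_ : NonZero m}} where

  open LargestPart m

  partsUpTo-1 : ∀ q {r} → r < m → partsUpTo m 1 (q * m + r) ≡ suc q
  partsUpTo-1 zero    {r} r<m = partsUpTo-suc-< 0 r (subst (r <_) (sym (*-identityʳ m)) r<m)
  partsUpTo-1 (suc q) {r} r<m = begin
    partsUpTo m 1 (suc q * m + r)         ≡⟨ cong (partsUpTo m 1) (regroup m q r) ⟩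
    partsUpTo m 1 (m ^ 1 + (q * m + r))   ≡⟨ partsUpTo-suc-+ 0 (q * m + r) ⟩
    1 + partsUpTo m 1 (q * m + r)         ≡⟨ cong suc (partsUpTo-1 q r<m) ⟩
    suc (suc q)                           ∎
    where
    open ≡-Reasoning
    regroup : ∀ m q r → suc q * m + r ≡ m * 1 + (q * m + r)
    regroup = solve-∀

  partsUpTo-2 : ∀ a {e r} → e < m → r < m → partsUpTo m 2 ((a * m + e) * m + r) ≡ digitCount m a e
  partsUpTo-2 zero    {e} {r} e<m r<m = begin
    partsUpTo m 2 (e * m + r)  ≡⟨ partsUpTo-suc-< 1 _ (subst (e * m + r <_) m*m≡m^2 (q*m+r<n*m e<m r<m)) ⟩
    partsUpTo m 1 (e * m + r)  ≡⟨ partsUpTo-1 e r<m ⟩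
    suc e                      ∎
    where
    open ≡-Reasoning
    m*m≡m^2 : m * m ≡ m * (m * 1)
    m*m≡m^2 = cong (m *_) (sym (*-identityʳ m))
  partsUpTo-2 (suc a) {e} {r} e<m r<m = begin
    partsUpTo m 2 ((suc a * m + e) * m + r)   ≡⟨ cong (partsUpTo m 2) (regroup m a e r) ⟩
    partsUpTo m 2 (m ^ 2 + n)                 ≡⟨ partsUpTo-suc-+ 1 n ⟩
    partsUpTo m 1 (m ^ 2 + n) + partsUpTo m 2 n
      ≡⟨ cong₂ _+_ (trans (cong (partsUpTo m 1) (sym (regroup m a e r))) (partsUpTo-1 (suc a * m + e) r<m))
                   (partsUpTo-2 a e<m r<m) ⟩
    suc (suc a * m + e) + digitCount m a e    ≡⟨ cong (_+ digitCount m a e) (sym (+-suc (suc a * m) e)) ⟩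
    digitCount m (suc a) e                    ∎
    where
    open ≡-Reasoning
    n = (a * m + e) * m + r
    regroup : ∀ m a e r → (suc a * m + e) * m + r ≡ m * (m * 1) + ((a * m + e) * m + r)
    regroup = solve-∀

  partsUpTo-stable : ∀ i {j n} → n < m ^ suc j → partsUpTo m (i + j) n ≡ partsUpTo m j n
  partsUpTo-stable zero        n<m^j = refl
  partsUpTo-stable (suc i) {j} n<m^j =
    trans (partsUpTo-suc-< (i + j) _ (<-≤-trans n<m^j (^-monoʳ-≤ m (s≤s (m≤n+m j i)))))
          (partsUpTo-stable i n<m^j)

  b≡partsUpTo-2 : ∀ {n} → 2 ≤ m → n < m ^ 3 → b m n ≡ partsUpTo m 2 n
  b≡partsUpTo-2 {zero}        2≤m n<m³ = refl
  b≡partsUpTo-2 {suc zero}    2≤m n<m³ = trans (partsUpTo-stable 1 {0} 1<m¹) (sym (partsUpTo-stable 2 {0} 1<m¹))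
    where
    1<m¹ : 1 < m ^ 1
    1<m¹ = subst (1 <_) (sym (*-identityʳ m)) 2≤m
  b≡partsUpTo-2 {suc (suc n)} 2≤m n<m³ =
    trans (cong (λ j → partsUpTo m j (2 + n)) (+-comm 2 n)) (partsUpTo-stable n n<m³)

  b-digits : ∀ {n a e r} → 2 ≤ m → n ≡ (a * m + e) * m + r → a < m → e < m → r < m →
             b m n ≡ digitCount m a e
  b-digits {n} {a} {e} {r} 2≤m refl a<m e<m r<m =
    trans (b≡partsUpTo-2 2≤m n<m³) (partsUpTo-2 a e<m r<m)
    where
    cube : ∀ m → m * m * m ≡ m * (m * (m * 1))
    cube = solve-∀
    n<m³ : n < m ^ 3
    n<m³ = subst (n <_) (cube m) (q*m+r<n*m (q*m+r<n*m a<m e<m) r<m)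

  b-m+r : ∀ {r} → 2 ≤ m → r < m → b m (m + r) ≡ 2
  b-m+r {r} 2≤m r<m = b-digits 2≤m (cong (_+ r) (sym (+-identityʳ m))) (<-≤-trans z<s 2≤m) 2≤m r<m

  low-digit : ∀ {w} → m ≤ w → w ≤ 2 * m ∸ 1 → ∃[ r ] r < m × w ≡ m + r
  low-digit {w} m≤w w≤2m∸1 = w ∸ m , +-cancelˡ-< m (w ∸ m) m m+r<m+m , sym (m+[n∸m]≡n m≤w)
    where
    m+r<m+m : m + (w ∸ m) < m + m
    m+r<m+m = subst₂ _<_ (sym (m+[n∸m]≡n m≤w)) (cong (m +_) (+-identityʳ m))
                     (m≤pred[n]⇒suc[m]≤n {{m*n≢0 2 m}} w≤2m∸1)

  m+r+[k*m+l] : ∀ k {r l} → r < m → l < m → ∃[ s ] s < m ×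
    (m + r + (k * m + l) ≡ (k + 1) * m + s ⊎ m + r + (k * m + l) ≡ (k + 2) * m + s)
  m+r+[k*m+l] k {r} {l} r<m l<m with digit+carry (+-mono-< r<m l<m)
  ... | s , s<m , inj₁ refl = s , s<m , inj₁ (regroup m r l k)
    where
    regroup : ∀ m r l k → m + r + (k * m + l) ≡ (k + 1) * m + (r + l)
    regroup = solve-∀
  ... | s , s<m , inj₂ r+l≡m+s = s , s<m , inj₂ (begin
    m + r + (k * m + l)    ≡⟨ regroup m r l k ⟩
    (k + 1) * m + (r + l)  ≡⟨ cong ((k + 1) * m +_) r+l≡m+s ⟩
    (k + 1) * m + (m + s)  ≡⟨ carry m k s ⟩
    (k + 2) * m + s        ∎)
    where
    open ≡-Reasoning
    regroup : ∀ m r l k → m + r + (k * m + l) ≡ (k + 1) * m + (r + l)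
    regroup = solve-∀
    carry : ∀ m k s → (k + 1) * m + (m + s) ≡ (k + 2) * m + s
    carry = solve-∀

  b[m+r]*b[m+l] : ∀ {r l} → 2 ≤ m → r < m → l < m → b m (m + r) * b m (1 * m + l) ≡ 4
  b[m+r]*b[m+l] {r} {l} 2≤m r<m l<m =
    cong₂ _*_ (b-m+r 2≤m r<m) (trans (cong (λ x → b m (x + l)) (*-identityˡ m)) (b-m+r 2≤m l<m))

  b-k≡1 : ∀ {r l} → 4 ≤ m → r < m → l < m →
    (b m (m + r) * b m (1 * m + l) ≥ b m (m + r + (1 * m + l)))
    × (m + r + (1 * m + l) ≥ 3 * m → b m (m + r) * b m (1 * m + l) ≡ b m (m + r + (1 * m + l)))
  b-k≡1 {r} {l} 4≤m r<m l<m with m+r+[k*m+l] 1 r<m l<m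
  ... | s , s<m , inj₁ w+z≡2m+s =
    subst₂ _≤_ (sym b[w+z]≡3) (sym (b[m+r]*b[m+l] 2≤m r<m l<m)) (n≤1+n 3) ,
    λ 3m≤w+z → ⊥-elim (<⇒≱ (subst (_< 3 * m) (sym w+z≡2m+s) (q*m+r<n*m {q = 2} ≤-refl s<m)) 3m≤w+z)
    where
    2≤m = ≤-trans (m≤m+n 2 2) 4≤m
    b[w+z]≡3 : b m (m + r + (1 * m + l)) ≡ 3
    b[w+z]≡3 = b-digits {a = 0} 2≤m w+z≡2m+s (<-≤-trans z<s 4≤m) (≤-trans (m≤m+n 3 1) 4≤m) s<m
  ... | s , s<m , inj₂ w+z≡3m+s =
    ≤-reflexive (trans b[w+z]≡4 (sym b[w]*b[z]≡4)) , λ _ → trans b[w]*b[z]≡4 (sym b[w+z]≡4)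
    where
    2≤m = ≤-trans (m≤m+n 2 2) 4≤m
    b[w]*b[z]≡4 = b[m+r]*b[m+l] 2≤m r<m l<m
    b[w+z]≡4 : b m (m + r + (1 * m + l)) ≡ 4
    b[w+z]≡4 = b-digits {a = 0} 2≤m w+z≡3m+s (<-≤-trans z<s 4≤m) 4≤m s<m

  b-<-2*digitCount : ∀ {n a e c s} → 6 ≤ m → n ≡ (a * m + e + c) * m + s →
    suc a < m → e < m → 2 ≤ a * m + e → c ≤ 2 → s < m → b m n < 2 * digitCount m a e
  b-<-2*digitCount {n} {a} {e} {c} {s} 6≤m n≡ 1+a<m e<m 2≤a*m+e c≤2 s<m
    with digit+carry {m} {e + c} (+-mono-<-≤ e<m (≤-trans c≤2 (≤-trans (m≤m+n 2 4) 6≤m)))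
  ... | _ , e+c<m , inj₁ refl = begin-strict
    b m n                          ≡⟨ b-digits 2≤m n≡′ (<-trans (n<1+n a) 1+a<m) e+c<m s<m ⟩
    digitCount m a (e + c)         <⟨ digitCount-+-< {a = a} (≤-trans (m≤m+n 4 2) 6≤m) c≤2 2≤a*m+e ⟩
    2 * digitCount m a e           ∎
    where
    open ≤-Reasoning
    2≤m = ≤-trans (m≤m+n 2 4) 6≤m
    n≡′ : n ≡ (a * m + (e + c)) * m + s
    n≡′ = trans n≡ (cong (λ x → x * m + s) (+-assoc (a * m) e c))
  ... | e′ , e′<m , inj₂ e+c≡m+e′ = begin-strict
    b m n                          ≡⟨ b-digits 2≤m (trans n≡ (cong (λ x → x * m + s) carry)) 1+a<m e′<m s<m ⟩
    digitCount m (suc a) e′        <⟨ digitCount-carry-< {a = a} (≤-trans (m≤m+n 5 1) 6≤m) m+e′≤e+2 ⟩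
    2 * digitCount m a e           ∎
    where
    open ≤-Reasoning
    2≤m = ≤-trans (m≤m+n 2 4) 6≤m
    m+e′≤e+2 : m + e′ ≤ e + 2
    m+e′≤e+2 = subst (_≤ e + 2) e+c≡m+e′ (+-monoʳ-≤ e c≤2)
    carry : a * m + e + c ≡ suc a * m + e′
    carry = begin-equality
      a * m + e + c      ≡⟨ +-assoc (a * m) e c ⟩
      a * m + (e + c)    ≡⟨ cong (a * m +_) e+c≡m+e′ ⟩
      a * m + (m + e′)   ≡⟨ sym (+-assoc (a * m) m e′) ⟩
      a * m + m + e′     ≡⟨ cong (_+ e′) (+-comm (a * m) m) ⟩
      suc a * m + e′     ∎

  b-k≥2 : ∀ {r k l} → 6 ≤ m → r < m → l < m → 2 ≤ k → k < 5 * m →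
    b m (m + r + (k * m + l)) < b m (m + r) * b m (k * m + l)
  b-k≥2 {r} {k} {l} 6≤m r<m l<m 2≤k k<5m =
    subst (b m (m + r + (k * m + l)) <_) (sym b[w]*b[z]≡) b[w+z]<
    where
    a = k / m
    e = k % m
    2≤m = ≤-trans (m≤m+n 2 4) 6≤m
    k≡ : k ≡ a * m + e
    k≡ = trans (m≡m%n+[m/n]*n k m) (+-comm e (a * m))
    2≤a*m+e : 2 ≤ a * m + e
    2≤a*m+e = subst (2 ≤_) k≡ 2≤k
    1+a<m : suc a < m
    1+a<m = <-≤-trans (s≤s (m<n*o⇒m/o<n k<5m)) 6≤m
    b[w]*b[z]≡ : b m (m + r) * b m (k * m + l) ≡ 2 * digitCount m a e
    b[w]*b[z]≡ = cong₂ _*_ (b-m+r 2≤m r<m)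
      (b-digits 2≤m (cong (λ x → x * m + l) k≡) (<-trans (n<1+n a) 1+a<m) (m%n<n k m) l<m)
    b[w+z]< : b m (m + r + (k * m + l)) < 2 * digitCount m a e
    b[w+z]< with m+r+[k*m+l] k r<m l<m
    ... | s , s<m , inj₁ w+z≡ =
      b-<-2*digitCount 6≤m (trans w+z≡ (cong (λ x → (x + 1) * m + s) k≡)) 1+a<m (m%n<n k m) 2≤a*m+e (s≤s z≤n) s<m
    ... | s , s<m , inj₂ w+z≡ =
      b-<-2*digitCount 6≤m (trans w+z≡ (cong (λ x → (x + 2) * m + s) k≡)) 1+a<m (m%n<n k m) 2≤a*m+e ≤-refl s<m

lemma4p2 : (m w k l : ℕ) → 4 ≤ m → m ≤ w → w ≤ 2 * m ∸ 1 →
    1 ≤ k → k ≤ 5 * m ∸ 1 → l < m →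
    (k ≡ 1 →
      (b m w * b m (k * m + l) ≥ b m (w + (k * m + l)))
      × (w + (k * m + l) ≥ 3 * m → b m w * b m (k * m + l) ≡ b m (w + (k * m + l))))
    × (2 ≤ k → 6 ≤ m → b m w * b m (k * m + l) > b m (w + (k * m + l)))
lemma4p2 m@(suc _) w k l 4≤m m≤w w≤2m∸1 _ k≤5m∸1 l<m
  with r , r<m , refl ← low-digit m m≤w w≤2m∸1 =
    (λ { refl → b-k≡1 m 4≤m r<m l<m }) ,
    (λ 2≤k 6≤m → b-k≥2 m 6≤m r<m l<m 2≤k (m≤pred[n]⇒suc[m]≤n k≤5m∸1))
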